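{- Let $d=d(n)$ with $d=o(n)$. Then for all sufficiently large $n$ (with $dn$ even) the following holds. Let $U,W\subseteq[n]$ be two (not necessarily disjoint) sets of vertices with $|U|=u$, $|W|=w$ and $w\leq u\leq\frac{n}{10}$, and let $\mathcal{E}_i$ denote the set of all (simple) $d$-regular graphs on vertex set $[n]$ in which there are exactly $i$ edges with one endpoint in $U$ and the other in $W$. Then for every $i\ge1$, $$\frac{|\mathcal{E}_i|}{|\mathcal{E}_{i-1}|}<\frac{2uwd}{in}.$$ Moreover, $|\mathcal{E}_i|$ is monotonically decreasing for $i>\frac{2uwd}{n}$.
   Context: Graphs are simple, on the labeled vertex set $[n]$. -}

module Defs where

open import Data.Bool using (Bool; true; false; _∧_; _∨_; not; _xor_)
open import Data.Nat using (ℕ; zero; suc; _<ᵇ_; _≡ᵇ_)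
open import Data.Fin using (Fin; toℕ)
open import Data.Fin.Subset using (Subset)
open import Data.List using (List; []; _∷_; [_]; map; concatMap; length; filterᵇ; allFin; cartesianProduct)
open import Data.Vec using (Vec; lookup) renaming ([] to []ᵥ; _∷_ to _∷ᵥ_)
open import Data.Product using (_,_)
open import Data.Bool.ListAction using (all)

allVecs : {A : Set} → List A → (n : ℕ) → List (Vec A n)
allVecs xs zero    = [ []ᵥ ]
allVecs xs (suc n) = concatMap (λ x → map (x ∷ᵥ_) (allVecs xs n)) xs

-- a labelled (loopless, symmetric) graph on [n] = Fin n is given by its adjacency matrix
AdjMatrix : ℕ → Set
AdjMatrix n = Vec (Vec Bool n) n

adj : {n : ℕ} → AdjMatrix n → Fin n → Fin n → Bool
adj M x y = lookup (lookup M x) y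

allMatrices : (n : ℕ) → List (AdjMatrix n)
allMatrices n = allVecs (allVecs (true ∷ false ∷ []) n) n

pairs : (n : ℕ) → List (Data.Product._×_ (Fin n) (Fin n))
pairs n = cartesianProduct (allFin n) (allFin n)

isSimple : {n : ℕ} → AdjMatrix n → Bool
isSimple {n} M =
  all (λ { (x , y) → not (adj M x y xor adj M y x) }) (pairs n)
  ∧ all (λ x → not (adj M x x)) (allFin n)

degree : {n : ℕ} → AdjMatrix n → Fin n → ℕ
degree {n} M x = length (filterᵇ (λ y → adj M x y) (allFin n))

isRegGraph : {n : ℕ} → ℕ → AdjMatrix n → Bool
isRegGraph {n} d M = isSimple M ∧ all (λ x → degree M x ≡ᵇ d) (allFin n)

edgesBetween : {n : ℕ} → Subset n → Subset n → AdjMatrix n → ℕ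
edgesBetween {n} U W M = length (filterᵇ
  (λ { (x , y) → (toℕ x <ᵇ toℕ y) ∧ adj M x y
        ∧ ((lookup U x ∧ lookup W y) ∨ (lookup W x ∧ lookup U y)) })
  (pairs n))

numE : (n d : ℕ) → Subset n → Subset n → ℕ → ℕ
numE n d U W i = length (filterᵇ (λ M → isRegGraph d M ∧ (edgesBetween U W M ≡ᵇ i)) (allMatrices n))

module Submission where

-- Call (x, y, a, b) a forward switching of G ∈ 𝓔ᵢ₊₁ if x ∈ U, y ∈ W, xy and ab
-- are edges, a, b ∉ U ∪ W, a ∉ N(x) ∪ {x, y} and b ∉ N(y) ∪ {x, y}. Replacing xy, ab by xa, yb
-- keeps G d-regular and lands in 𝓔ᵢ, and the switching (x, a, y, b) undoes it, so every graph of
-- 𝓔ᵢ is produced from at most one graph by a given quadruple. A graph of 𝓔ᵢ admits at most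
-- |U|d · |W|d quadruples with x ∈ U, y ∈ W, xa and yb edges. Conversely each of the i + 1 U–W
-- edges of G ∈ 𝓔ᵢ₊₁ gives an ordered pair (x, y), and for it at most 2(|U| + |W| + d + 2)d of
-- the nd ordered edges ab are forbidden; when 4(|U| + |W| + d + 2) < n this leaves at least
-- (dn + 1)/2 choices of ab. Double counting the pairs (G, quadruple) gives
-- |𝓔ᵢ₊₁| (i + 1)(dn + 1) ≤ 2 |𝓔ᵢ| |U|d |W|d, and dividing by d gives the strict bound.

open import Algebra.Properties.CommutativeSemigroup using (interchange)
open import Data.Bool using (Bool; true; false; _∧_; _∨_; not; _xor_; T)
open import Data.Bool.ListAction using (all)
open import Data.Bool.Properties as Bool
  using (∧-zeroʳ; ∨-comm; xor-assoc; xor-same; xor-identityʳ; not-injective; T-∧; T-∨; T-not-≡;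
         ∧-conicalˡ; ∧-conicalʳ; ∨-conicalˡ; ∨-conicalʳ)
open import Data.Empty using (⊥-elim)
open import Data.Fin using (Fin; zero; suc; toℕ)
open import Data.Fin.Properties using (_≟_; toℕ-injective)
open import Data.Fin.Subset using (Subset; ∣_∣)
open import Data.List using (List; []; _∷_; _++_; map; concat; concatMap; length; filterᵇ; allFin; cartesianProduct)
open import Data.List.Membership.Propositional using (_∈_)
open import Data.List.Membership.Propositional.Properties using (∈-allFin; ∈-cartesianProduct⁺)
open import Data.List.Properties using (map-tabulate; length-tabulate)
open import Data.List.Relation.Unary.All as All using ()
open import Data.List.Relation.Unary.All.Properties using (all⁺; all⁻)
open import Data.List.Relation.Unary.Any using (here; there)
open import Data.Nat using (ℕ; zero; suc; _+_; _*_; _≤_; _<_; z≤n; s≤s; _<ᵇ_; _≡ᵇ_)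
open import Data.Nat.Divisibility using (_∣_)
open import Data.Nat.Properties hiding (_≟_)
open import Data.Nat.Tactic.RingSolver using (solve-∀)
open import Data.Product as Product using (_×_; _,_; proj₁; proj₂; ∃-syntax)
open import Data.Sum as Sum using (_⊎_; inj₁; inj₂)
open import Data.Vec using (Vec; lookup; tabulate) renaming ([] to []ᵥ; _∷_ to _∷ᵥ_)
open import Data.Vec.Properties using (≡-dec; lookup∘tabulate; tabulate∘lookup; tabulate-cong)
open import Function using (_∘_; case_of_)
open import Function.Bundles using (Equivalence)
open import Relation.Binary.Definitions using (DecidableEquality)
open import Relation.Binary.PropositionalEquality
open import Relation.Nullary using (¬_)
open import Relation.Nullary.Decidable using (does; yes; no)

open import Defs

-- Booleans, indicators and finite sums

¬T⇒≡false : ∀ {b} → ¬ T b → b ≡ false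
¬T⇒≡false {false} _  = refl
¬T⇒≡false {true}  ¬t = ⊥-elim (¬t _)

T⇒≡true : ∀ {b} → T b → b ≡ true
T⇒≡true = Equivalence.to Bool.T-≡

≡true⇒T : ∀ {b} → b ≡ true → T b
≡true⇒T = Equivalence.from Bool.T-≡

𝟙 : Bool → ℕ
𝟙 true  = 1
𝟙 false = 0

𝟙-∧ : ∀ a b → 𝟙 (a ∧ b) ≡ 𝟙 a * 𝟙 b
𝟙-∧ true  b = sym (*-identityˡ (𝟙 b))
𝟙-∧ false b = refl

𝟙-∨ : ∀ a b → a ∧ b ≡ false → 𝟙 (a ∨ b) ≡ 𝟙 a + 𝟙 b
𝟙-∨ true  false _ = refl
𝟙-∨ false b     _ = refl

𝟙-∨-≤ : ∀ a b → 𝟙 (a ∨ b) ≤ 𝟙 a + 𝟙 b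
𝟙-∨-≤ true  b = s≤s z≤n
𝟙-∨-≤ false b = ≤-refl

𝟙-mono : ∀ {a b} → (T a → T b) → 𝟙 a ≤ 𝟙 b
𝟙-mono {false}         _   = z≤n
𝟙-mono {true}  {true}  _   = ≤-refl
𝟙-mono {true}  {false} a⇒b = ⊥-elim (a⇒b _)

𝟙-*-mono : ∀ e {x y} → (T e → x ≤ y) → 𝟙 e * x ≤ 𝟙 e * y
𝟙-*-mono false _   = z≤n
𝟙-*-mono true  x≤y = +-monoˡ-≤ 0 (x≤y _)

𝟙-*-cong : ∀ e {x y} → (T e → x ≡ y) → 𝟙 e * x ≡ 𝟙 e * y
𝟙-*-cong false _   = refl
𝟙-*-cong true  x≡y = cong (_+ 0) (x≡y _)

𝟙-<ᵇ-total : ∀ m n → m ≢ n → 𝟙 (m <ᵇ n) + 𝟙 (n <ᵇ m) ≡ 1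
𝟙-<ᵇ-total zero    zero    m≢n = ⊥-elim (m≢n refl)
𝟙-<ᵇ-total zero    (suc n) _   = refl
𝟙-<ᵇ-total (suc m) zero    _   = refl
𝟙-<ᵇ-total (suc m) (suc n) m≢n = 𝟙-<ᵇ-total m n (m≢n ∘ cong suc)

𝟙-<ᵇ-asym : ∀ m n → 𝟙 (m <ᵇ n) + 𝟙 (n <ᵇ m) ≤ 1
𝟙-<ᵇ-asym zero    zero    = z≤n
𝟙-<ᵇ-asym zero    (suc n) = ≤-refl
𝟙-<ᵇ-asym (suc m) zero    = ≤-refl
𝟙-<ᵇ-asym (suc m) (suc n) = 𝟙-<ᵇ-asym m n

∑ : {A : Set} → List A → (A → ℕ) → ℕ
∑ []       f = 0
∑ (x ∷ xs) f = f x + ∑ xs f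

syntax ∑ xs (λ x → e) = ∑[ x ∈ xs ] e

∑< : (n : ℕ) → (Fin n → ℕ) → ℕ
∑< n = ∑ (allFin n)

syntax ∑< n (λ x → e) = ∑[ x < n ] e

∑-map : ∀ {A B : Set} (g : A → B) xs (f : B → ℕ) → ∑ (map g xs) f ≡ ∑ xs (f ∘ g)
∑-map g []       f = refl
∑-map g (x ∷ xs) f = cong (f (g x) +_) (∑-map g xs f)

module _ {A : Set} where

  ∑-cong : ∀ xs {f g : A → ℕ} → (∀ x → f x ≡ g x) → ∑ xs f ≡ ∑ xs g
  ∑-cong []       f≡g = refl
  ∑-cong (x ∷ xs) f≡g = cong₂ _+_ (f≡g x) (∑-cong xs f≡g)

  ∑-mono : ∀ xs {f g : A → ℕ} → (∀ x → f x ≤ g x) → ∑ xs f ≤ ∑ xs g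
  ∑-mono []       f≤g = z≤n
  ∑-mono (x ∷ xs) f≤g = +-mono-≤ (f≤g x) (∑-mono xs f≤g)

  ∑-distrib-+ : ∀ xs (f g : A → ℕ) → ∑[ x ∈ xs ] (f x + g x) ≡ ∑ xs f + ∑ xs g
  ∑-distrib-+ []       f g = refl
  ∑-distrib-+ (x ∷ xs) f g =
    trans (cong (f x + g x +_) (∑-distrib-+ xs f g))
          (interchange +-commutativeSemigroup (f x) (g x) (∑ xs f) (∑ xs g))

  ∑-*ˡ : ∀ xs c (f : A → ℕ) → ∑[ x ∈ xs ] (c * f x) ≡ c * ∑ xs f
  ∑-*ˡ []       c f = sym (*-zeroʳ c)
  ∑-*ˡ (x ∷ xs) c f = trans (cong (c * f x +_) (∑-*ˡ xs c f)) (sym (*-distribˡ-+ c (f x) (∑ xs f)))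

  ∑-*ʳ : ∀ xs c (f : A → ℕ) → ∑[ x ∈ xs ] (f x * c) ≡ ∑ xs f * c
  ∑-*ʳ xs c f = trans (∑-cong xs (λ x → *-comm (f x) c)) (trans (∑-*ˡ xs c f) (*-comm c (∑ xs f)))

  ∑-const : ∀ (xs : List A) c → ∑[ x ∈ xs ] c ≡ length xs * c
  ∑-const []       c = refl
  ∑-const (x ∷ xs) c = cong (c +_) (∑-const xs c)

  ∑-++ : ∀ xs ys (f : A → ℕ) → ∑ (xs ++ ys) f ≡ ∑ xs f + ∑ ys f
  ∑-++ []       ys f = refl
  ∑-++ (x ∷ xs) ys f = trans (cong (f x +_) (∑-++ xs ys f)) (sym (+-assoc (f x) (∑ xs f) (∑ ys f)))

  ∑-concat : ∀ xss (f : A → ℕ) → ∑ (concat xss) f ≡ ∑[ xs ∈ xss ] ∑ xs f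
  ∑-concat []         f = refl
  ∑-concat (xs ∷ xss) f = trans (∑-++ xs (concat xss) f) (cong (∑ xs f +_) (∑-concat xss f))

  f≤∑ : ∀ {xs} (f : A → ℕ) {x} → x ∈ xs → f x ≤ ∑ xs f
  f≤∑ {y ∷ xs} f (here refl) = m≤m+n (f y) (∑ xs f)
  f≤∑ {y ∷ xs} f (there x∈) = ≤-trans (f≤∑ f x∈) (m≤n+m (∑ xs f) (f y))

module _ {A B : Set} where

  ∑-concatMap : ∀ (g : A → List B) xs (f : B → ℕ) → ∑ (concatMap g xs) f ≡ ∑[ x ∈ xs ] ∑ (g x) f
  ∑-concatMap g xs f = trans (∑-concat (map g xs) f) (∑-map g xs (λ ys → ∑ ys f))

  ∑-comm : ∀ xs ys (f : A → B → ℕ) → ∑[ x ∈ xs ] ∑[ y ∈ ys ] f x y ≡ ∑[ y ∈ ys ] ∑[ x ∈ xs ] f x y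
  ∑-comm []       ys f = sym (trans (∑-const ys 0) (*-zeroʳ (length ys)))
  ∑-comm (x ∷ xs) ys f = trans (cong (∑ ys (f x) +_) (∑-comm xs ys f)) (sym (∑-distrib-+ ys (f x) _))

  ∑-cartesianProduct : ∀ xs ys (f : A × B → ℕ) → ∑ (cartesianProduct xs ys) f ≡ ∑[ x ∈ xs ] ∑[ y ∈ ys ] f (x , y)
  ∑-cartesianProduct []       ys f = refl
  ∑-cartesianProduct (x ∷ xs) ys f =
    trans (∑-++ (map (x ,_) ys) (cartesianProduct xs ys) f)
          (cong₂ _+_ (∑-map (x ,_) ys f) (∑-cartesianProduct xs ys f))

∑∑-𝟙-∧ : ∀ {A B : Set} (xs : List A) (ys : List B) (E : A → Bool) (F : A → B → Bool)
  → ∑[ t ∈ ys ] ∑[ m ∈ xs ] 𝟙 (E m ∧ F m t) ≡ ∑[ m ∈ xs ] (𝟙 (E m) * ∑[ t ∈ ys ] 𝟙 (F m t))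
∑∑-𝟙-∧ xs ys E F = trans (∑-comm ys xs _) (∑-cong xs λ m →
  trans (∑-cong ys (λ t → 𝟙-∧ (E m) (F m t))) (∑-*ˡ ys (𝟙 (E m)) _))

length-filterᵇ : ∀ {A : Set} (p : A → Bool) xs → length (filterᵇ p xs) ≡ ∑[ x ∈ xs ] 𝟙 (p x)
length-filterᵇ p []       = refl
length-filterᵇ p (x ∷ xs) with p x
... | true  = cong suc (length-filterᵇ p xs)
... | false = length-filterᵇ p xs

∑-allFin-suc : ∀ n (f : Fin (suc n) → ℕ) → ∑[ q < suc n ] f q ≡ f zero + ∑[ q < n ] f (suc q)
∑-allFin-suc n f =
  cong (f zero +_) (trans (cong (λ qs → ∑ qs f) (sym (map-tabulate (λ q → q) suc))) (∑-map suc (allFin n) f))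

-- Lists enumerating a type, and counting by injection

module Enumeration {A : Set} (_≟ᴬ_ : DecidableEquality A) where

  Enumerates : List A → Set
  Enumerates xs = ∀ a → ∑[ b ∈ xs ] 𝟙 (does (b ≟ᴬ a)) ≡ 1

  ≟-complete : ∀ {a b} → a ≡ b → T (does (a ≟ᴬ b))
  ≟-complete {a} refl with a ≟ᴬ a
  ... | yes _   = _
  ... | no  a≢a = a≢a refl

  ∑-pointMass : ∀ xs → Enumerates xs → ∀ a (g : A → ℕ) → ∑[ b ∈ xs ] (𝟙 (does (b ≟ᴬ a)) * g b) ≡ g a
  ∑-pointMass xs once a g = begin
    ∑[ b ∈ xs ] (𝟙 (does (b ≟ᴬ a)) * g b)  ≡⟨ ∑-cong xs at-a ⟩
    ∑[ b ∈ xs ] (𝟙 (does (b ≟ᴬ a)) * g a)  ≡⟨ ∑-*ʳ xs (g a) _ ⟩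
    (∑[ b ∈ xs ] 𝟙 (does (b ≟ᴬ a))) * g a ≡⟨ cong (_* g a) (once a) ⟩
    1 * g a                               ≡⟨ *-identityˡ (g a) ⟩
    g a                                   ∎
    where
    open ≡-Reasoning
    at-a : ∀ b → 𝟙 (does (b ≟ᴬ a)) * g b ≡ 𝟙 (does (b ≟ᴬ a)) * g a
    at-a b with b ≟ᴬ a
    ... | yes refl = refl
    ... | no  _    = refl

  ∑-𝟙-∧-once : ∀ xs → Enumerates xs → ∀ c a → ∑[ b ∈ xs ] 𝟙 (c ∧ does (b ≟ᴬ a)) ≡ 𝟙 c
  ∑-𝟙-∧-once xs once c a = begin
    ∑[ b ∈ xs ] 𝟙 (c ∧ does (b ≟ᴬ a))     ≡⟨ ∑-cong xs (λ b → 𝟙-∧ c _) ⟩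
    ∑[ b ∈ xs ] (𝟙 c * 𝟙 (does (b ≟ᴬ a))) ≡⟨ ∑-*ˡ xs (𝟙 c) _ ⟩
    𝟙 c * ∑[ b ∈ xs ] 𝟙 (does (b ≟ᴬ a))   ≡⟨ cong (𝟙 c *_) (once a) ⟩
    𝟙 c * 1                               ≡⟨ *-identityʳ (𝟙 c) ⟩
    𝟙 c                                   ∎
    where open ≡-Reasoning

  count-≤-by-retraction : ∀ xs → Enumerates xs → (P Q : A → Bool) (f g : A → A)
    → (∀ a → T (P a) → T (Q (f a))) → (∀ a → T (P a) → g (f a) ≡ a)
    → ∑[ a ∈ xs ] 𝟙 (P a) ≤ ∑[ a ∈ xs ] 𝟙 (Q a)
  count-≤-by-retraction xs once P Q f g P⇒Q∘f g∘f = begin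
    ∑[ a ∈ xs ] 𝟙 (P a)
      ≡⟨ ∑-cong xs (λ a → sym (∑-𝟙-∧-once xs once (P a) (f a))) ⟩
    ∑[ a ∈ xs ] ∑[ b ∈ xs ] 𝟙 (P a ∧ does (b ≟ᴬ f a))
      ≡⟨ ∑-comm xs xs _ ⟩
    ∑[ b ∈ xs ] ∑[ a ∈ xs ] 𝟙 (P a ∧ does (b ≟ᴬ f a))
      ≤⟨ ∑-mono xs (λ b → ∑-mono xs (λ a → 𝟙-mono (step a b))) ⟩
    ∑[ b ∈ xs ] ∑[ a ∈ xs ] 𝟙 (Q b ∧ does (a ≟ᴬ g b))
      ≡⟨ ∑-cong xs (λ b → ∑-𝟙-∧-once xs once (Q b) (g b)) ⟩
    ∑[ b ∈ xs ] 𝟙 (Q b) ∎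
    where
    open ≤-Reasoning
    step : ∀ a b → T (P a ∧ does (b ≟ᴬ f a)) → T (Q b ∧ does (a ≟ᴬ g b))
    step a b h with Equivalence.to (T-∧ {P a}) h
    ... | Pa , b≟fa with b ≟ᴬ f a
    ... | yes refl = Equivalence.from T-∧ (P⇒Q∘f a Pa , ≟-complete (sym (g∘f a Pa)))
    ... | no  _    = ⊥-elim b≟fa

open Enumeration

allFin-enumerates : ∀ n → Enumerates (_≟_ {n}) (allFin n)
allFin-enumerates (suc n) zero    = trans (∑-allFin-suc n (λ q → 𝟙 (does (q ≟ zero))))
                                          (cong suc (trans (∑-const (allFin n) 0) (*-zeroʳ (length (allFin n)))))
allFin-enumerates (suc n) (suc y) = trans (∑-allFin-suc n (λ q → 𝟙 (does (q ≟ suc y)))) (allFin-enumerates n y)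

allVecs-enumerates : ∀ {A : Set} (_≟ᴬ_ : DecidableEquality A) {xs} → Enumerates _≟ᴬ_ xs
  → ∀ n → Enumerates (≡-dec _≟ᴬ_) (allVecs xs n)
allVecs-enumerates _≟ᴬ_ once zero    []ᵥ        = refl
allVecs-enumerates _≟ᴬ_ {xs} once (suc n) (a ∷ᵥ v) = begin
  ∑ (concatMap (λ x → map (x ∷ᵥ_) (allVecs xs n)) xs) F
    ≡⟨ ∑-concatMap _ xs F ⟩
  ∑[ x ∈ xs ] ∑ (map (x ∷ᵥ_) (allVecs xs n)) F
    ≡⟨ ∑-cong xs (λ x → ∑-map (x ∷ᵥ_) (allVecs xs n) F) ⟩
  ∑[ x ∈ xs ] ∑[ u ∈ allVecs xs n ] 𝟙 (does (x ≟ᴬ a) ∧ does (≡-dec _≟ᴬ_ u v))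
    ≡⟨ ∑-cong xs (λ x → trans (∑-cong (allVecs xs n) (λ u → 𝟙-∧ (does (x ≟ᴬ a)) _))
                              (∑-*ˡ (allVecs xs n) (𝟙 (does (x ≟ᴬ a))) _)) ⟩
  ∑[ x ∈ xs ] (𝟙 (does (x ≟ᴬ a)) * ∑[ u ∈ allVecs xs n ] 𝟙 (does (≡-dec _≟ᴬ_ u v)))
    ≡⟨ ∑-cong xs (λ x → cong (𝟙 (does (x ≟ᴬ a)) *_) (allVecs-enumerates _≟ᴬ_ once n v)) ⟩
  ∑[ x ∈ xs ] (𝟙 (does (x ≟ᴬ a)) * 1)
    ≡⟨ ∑-pointMass _≟ᴬ_ xs once a (λ _ → 1) ⟩
  1 ∎
  where
  open ≡-Reasoning
  F : Vec _ (suc n) → ℕ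
  F u = 𝟙 (does (≡-dec _≟ᴬ_ u (a ∷ᵥ v)))

_≟ᴹ_ : ∀ {n} → DecidableEquality (AdjMatrix n)
_≟ᴹ_ = ≡-dec (≡-dec Bool._≟_)

allMatrices-enumerates : ∀ n → Enumerates _≟ᴹ_ (allMatrices n)
allMatrices-enumerates n = allVecs-enumerates _ (allVecs-enumerates Bool._≟_ bools n) n
  where
  bools : Enumerates Bool._≟_ (true ∷ false ∷ [])
  bools true  = refl
  bools false = refl

-- Regular graphs as adjacency matrices

all-sound : ∀ {A : Set} (p : A → Bool) {xs x} → T (all p xs) → x ∈ xs → T (p x)
all-sound p t x∈xs = All.lookup (all⁺ p _ t) x∈xs

all-complete : ∀ {A : Set} (p : A → Bool) xs → (∀ x → T (p x)) → T (all p xs)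
all-complete p xs px = all⁻ p (All.universal px xs)

not-xor⇒≡ : ∀ a b → T (not (a xor b)) → a ≡ b
not-xor⇒≡ true  true  _ = refl
not-xor⇒≡ false false _ = refl

≡⇒not-xor : ∀ a → T (not (a xor a))
≡⇒not-xor true  = _
≡⇒not-xor false = _

record IsRegular {n : ℕ} (d : ℕ) (M : AdjMatrix n) : Set where
  field
    symmetric   : ∀ x y → adj M x y ≡ adj M y x
    irreflexive : ∀ x → adj M x x ≡ false
    degree-≡    : ∀ x → ∑[ y < n ] 𝟙 (adj M x y) ≡ d

isRegGraph⇒IsRegular : ∀ {n} d (M : AdjMatrix n) → T (isRegGraph d M) → IsRegular d M
isRegGraph⇒IsRegular {n} d M t = record
  { symmetric   = λ x y → not-xor⇒≡ _ _ (all-sound _ symmetric? (∈-cartesianProduct⁺ (∈-allFin x) (∈-allFin y)))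
  ; irreflexive = λ x → Equivalence.to T-not-≡ (all-sound _ loopless? (∈-allFin x))
  ; degree-≡    = λ x → trans (sym (length-filterᵇ (adj M x) (allFin n)))
                              (≡ᵇ⇒≡ _ d (all-sound _ regular? (∈-allFin x)))
  }
  where
  simple?    = proj₁ (Equivalence.to (T-∧ {isSimple M}) t)
  regular?   = proj₂ (Equivalence.to (T-∧ {isSimple M}) t)
  symmetric? = proj₁ (Equivalence.to T-∧ simple?)
  loopless?  = proj₂ (Equivalence.to T-∧ simple?)

IsRegular⇒isRegGraph : ∀ {n} d (M : AdjMatrix n) → IsRegular d M → T (isRegGraph d M)
IsRegular⇒isRegGraph {n} d M reg = Equivalence.from T-∧
  ( Equivalence.from T-∧
      ( all-complete _ (pairs n)
          (λ { (x , y) → subst (λ b → T (not (adj M x y xor b))) (symmetric x y) (≡⇒not-xor (adj M x y)) })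
      , all-complete _ (allFin n) (λ x → Equivalence.from T-not-≡ (irreflexive x)))
  , all-complete _ (allFin n) (λ x → ≡⇒≡ᵇ _ d (trans (length-filterᵇ (adj M x) (allFin n)) (degree-≡ x))))
  where open IsRegular reg

∣∣≡∑ : ∀ {n} (U : Subset n) → ∣ U ∣ ≡ ∑[ a < n ] 𝟙 (lookup U a)
∣∣≡∑ {zero}  []ᵥ        = refl
∣∣≡∑ {suc n} (true ∷ᵥ U)  = trans (cong suc (∣∣≡∑ U)) (sym (∑-allFin-suc n (𝟙 ∘ lookup (true ∷ᵥ U))))
∣∣≡∑ {suc n} (false ∷ᵥ U) = trans (∣∣≡∑ U) (sym (∑-allFin-suc n (𝟙 ∘ lookup (false ∷ᵥ U))))

∑-𝟙-lookup-* : ∀ {n} (V : Subset n) k → ∑[ x < n ] (𝟙 (lookup V x) * k) ≡ ∣ V ∣ * k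
∑-𝟙-lookup-* {n} V k = trans (∑-*ʳ (allFin n) k _) (cong (_* k) (sym (∣∣≡∑ V)))

between : ∀ {n} → Subset n → Subset n → Fin n → Fin n → Bool
between U W p q = (lookup U p ∧ lookup W q) ∨ (lookup W p ∧ lookup U q)

between-sym : ∀ {n} (U W : Subset n) p q → between U W p q ≡ between U W q p
between-sym U W p q =
  trans (cong₂ _∨_ (Bool.∧-comm (lookup U p) _) (Bool.∧-comm (lookup W p) _)) (∨-comm (lookup W q ∧ lookup U p) _)

between-∉ˡ : ∀ {n} (U W : Subset n) {a} → lookup U a ≡ false → lookup W a ≡ false → ∀ q → between U W a q ≡ false
between-∉ˡ U W a∉U a∉W q rewrite a∉U | a∉W = refl

between-∉ʳ : ∀ {n} (U W : Subset n) {a} → lookup U a ≡ false → lookup W a ≡ false → ∀ p → between U W p a ≡ false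
between-∉ʳ U W a∉U a∉W p rewrite a∉U | a∉W | ∧-zeroʳ (lookup U p) | ∧-zeroʳ (lookup W p) = refl

infix 7 _<ᶠ_

_<ᶠ_ : ∀ {n} → Fin n → Fin n → Bool
p <ᶠ q = toℕ p <ᵇ toℕ q

edgesBetween≡∑ : ∀ {n} (U W : Subset n) (M : AdjMatrix n)
  → edgesBetween U W M ≡ ∑[ p < n ] ∑[ q < n ] 𝟙 (p <ᶠ q ∧ adj M p q ∧ between U W p q)
edgesBetween≡∑ {n} U W M = trans (length-filterᵇ _ (pairs n)) (∑-cartesianProduct (allFin n) (allFin n) _)

𝓔? : ∀ {n} → ℕ → Subset n → Subset n → ℕ → AdjMatrix n → Bool
𝓔? d U W i M = isRegGraph d M ∧ (edgesBetween U W M ≡ᵇ i)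

𝓔?-sound : ∀ {n} d U W i (M : AdjMatrix n) → T (𝓔? d U W i M) → IsRegular d M × edgesBetween U W M ≡ i
𝓔?-sound d U W i M t =
  let reg , e = Equivalence.to (T-∧ {isRegGraph d M}) t
  in isRegGraph⇒IsRegular d M reg , ≡ᵇ⇒≡ _ i e

𝓔?-complete : ∀ {n} d U W i (M : AdjMatrix n) → IsRegular d M → edgesBetween U W M ≡ i → T (𝓔? d U W i M)
𝓔?-complete d U W i M reg e =
  Equivalence.from (T-∧ {isRegGraph d M}) (IsRegular⇒isRegGraph d M reg , ≡⇒≡ᵇ _ i e)

numE≡∑ : ∀ n d U W i → numE n d U W i ≡ ∑[ M ∈ allMatrices n ] 𝟙 (𝓔? d U W i M)
numE≡∑ n d U W i = length-filterᵇ _ (allMatrices n)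

fromFun : ∀ {n} → (Fin n → Fin n → Bool) → AdjMatrix n
fromFun f = tabulate (λ p → tabulate (f p))

adj-fromFun : ∀ {n} (f : Fin n → Fin n → Bool) p q → adj (fromFun f) p q ≡ f p q
adj-fromFun f p q = trans (cong (λ row → lookup row q) (lookup∘tabulate _ p)) (lookup∘tabulate (f p) q)

adj-ext : ∀ {n} {M N : AdjMatrix n} → (∀ p q → adj M p q ≡ adj N p q) → M ≡ N
adj-ext {M = M} {N} M≗N = begin
  M                   ≡⟨ sym (tabulate∘lookup M) ⟩
  tabulate (lookup M) ≡⟨ tabulate-cong row ⟩
  tabulate (lookup N) ≡⟨ tabulate∘lookup N ⟩
  N                   ∎
  where
  open ≡-Reasoning
  row : ∀ p → lookup M p ≡ lookup N p
  row p = begin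
    lookup M p            ≡⟨ sym (tabulate∘lookup (lookup M p)) ⟩
    tabulate (adj M p)    ≡⟨ tabulate-cong (M≗N p) ⟩
    tabulate (adj N p)    ≡⟨ tabulate∘lookup (lookup N p) ⟩
    lookup N p            ∎

-- Unordered pairs of vertices

module _ {n : ℕ} where

  does⇒≡ : ∀ {p x : Fin n} → T (does (p ≟ x)) → p ≡ x
  does⇒≡ {p} {x} t with p ≟ x
  ... | yes p≡x = p≡x

  does≡false⇒≢ : ∀ {p x : Fin n} → does (p ≟ x) ≡ false → p ≢ x
  does≡false⇒≢ {p} h p≡x = case trans (sym h) (T⇒≡true (≟-complete _≟_ {p} p≡x)) of λ ()

  ∑<-𝟙-∧-≟ : ∀ c (a : Fin n) → ∑[ q < n ] 𝟙 (c ∧ does (q ≟ a)) ≡ 𝟙 c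
  ∑<-𝟙-∧-≟ = ∑-𝟙-∧-once _≟_ (allFin n) (allFin-enumerates n)

  ∑<-pointMass : ∀ (a : Fin n) g → ∑[ q < n ] (𝟙 (does (q ≟ a)) * g q) ≡ g a
  ∑<-pointMass = ∑-pointMass _≟_ (allFin n) (allFin-enumerates n)

  pair : Fin n → Fin n → Fin n → Fin n → Bool
  pair x y p q = (does (p ≟ x) ∧ does (q ≟ y)) ∨ (does (p ≟ y) ∧ does (q ≟ x))

  pair-sym : ∀ x y p q → pair x y p q ≡ pair x y q p
  pair-sym x y p q = trans (∨-comm (does (p ≟ x) ∧ does (q ≟ y)) _)
                           (cong₂ _∨_ (Bool.∧-comm (does (p ≟ y)) _) (Bool.∧-comm (does (p ≟ x)) _))

  pair-refl : ∀ x y → T (pair x y x y)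
  pair-refl x y = Equivalence.from (T-∨ {does (x ≟ x) ∧ does (y ≟ y)})
                    (inj₁ (Equivalence.from (T-∧ {does (x ≟ x)})
                                            (≟-complete _≟_ {x} refl , ≟-complete _≟_ {y} refl)))

  does∧does⇒≡ : ∀ {p u q v : Fin n} → T (does (p ≟ u) ∧ does (q ≟ v)) → p ≡ u × q ≡ v
  does∧does⇒≡ {p} {u} t = Product.map does⇒≡ does⇒≡ (Equivalence.to (T-∧ {does (p ≟ u)}) t)

  pair-cases : ∀ {x y p q} → T (pair x y p q) → (p ≡ x × q ≡ y) ⊎ (p ≡ y × q ≡ x)
  pair-cases {x} {y} {p} {q} t =
    Sum.map does∧does⇒≡ does∧does⇒≡ (Equivalence.to (T-∨ {does (p ≟ x) ∧ does (q ≟ y)}) t)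

  pair-value : ∀ (f : Fin n → Fin n → Bool) → (∀ p q → f p q ≡ f q p)
    → ∀ {x y c p q} → f x y ≡ c → T (pair x y p q) → f p q ≡ c
  pair-value f f-sym {x} {y} {p = p} {q} fxy≡c t with pair-cases {x} {y} {p} {q} t
  ... | inj₁ (refl , refl) = fxy≡c
  ... | inj₂ (refl , refl) = trans (f-sym _ _) fxy≡c

  pair-∨-value : ∀ (f : Fin n → Fin n → Bool) → (∀ p q → f p q ≡ f q p)
    → ∀ {x y a b c p q} → f x y ≡ c → f a b ≡ c → T (pair x y p q ∨ pair a b p q) → f p q ≡ c
  pair-∨-value f f-sym {x} {y} {p = p} {q} fxy≡c fab≡c t with Equivalence.to (T-∨ {pair x y p q}) t
  ... | inj₁ t₁ = pair-value f f-sym fxy≡c t₁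
  ... | inj₂ t₂ = pair-value f f-sym fab≡c t₂

  pair-diagonal : ∀ {x y} → x ≢ y → ∀ p → pair x y p p ≡ false
  pair-diagonal {x} {y} x≢y p = ¬T⇒≡false λ t → case pair-cases {x} {y} {p} {p} t of λ
    { (inj₁ (refl , refl)) → x≢y refl
    ; (inj₂ (refl , refl)) → x≢y refl }

  pairs-disjoint : ∀ {x y a b} → a ≢ x → a ≢ y → ∀ p q → (pair x y p q ∧ pair a b p q) ≡ false
  pairs-disjoint {x} {y} {a} {b} a≢x a≢y p q = ¬T⇒≡false λ t →
    let t₁ , t₂ = Equivalence.to (T-∧ {pair x y p q}) t in
    case pair-cases {x} {y} {p} {q} t₁ , pair-cases {a} {b} {p} {q} t₂ of λ
      { (inj₁ (refl , refl) , inj₁ (refl , _)) → a≢x refl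
      ; (inj₁ (refl , refl) , inj₂ (_ , refl)) → a≢y refl
      ; (inj₂ (refl , refl) , inj₁ (refl , _)) → a≢y refl
      ; (inj₂ (refl , refl) , inj₂ (_ , refl)) → a≢x refl }

  𝟙-pair : ∀ {x y} → x ≢ y → ∀ p q
    → 𝟙 (pair x y p q) ≡ 𝟙 (does (p ≟ x) ∧ does (q ≟ y)) + 𝟙 (does (p ≟ y) ∧ does (q ≟ x))
  𝟙-pair {x} {y} x≢y p q = 𝟙-∨ (does (p ≟ x) ∧ does (q ≟ y)) _ (¬T⇒≡false λ t →
    let t₁ , t₂ = Equivalence.to (T-∧ {does (p ≟ x) ∧ does (q ≟ y)}) t in
    x≢y (trans (sym (proj₁ (does∧does⇒≡ {p} {x} {q} {y} t₁))) (proj₁ (does∧does⇒≡ {p} {y} {q} {x} t₂))))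

  ∑-pair-row : ∀ {x y} → x ≢ y → ∀ v → ∑[ q < n ] 𝟙 (pair x y v q) ≡ 𝟙 (does (v ≟ x)) + 𝟙 (does (v ≟ y))
  ∑-pair-row {x} {y} x≢y v = begin
    ∑[ q < n ] 𝟙 (pair x y v q)
      ≡⟨ ∑-cong (allFin n) (𝟙-pair x≢y v) ⟩
    ∑[ q < n ] (𝟙 (does (v ≟ x) ∧ does (q ≟ y)) + 𝟙 (does (v ≟ y) ∧ does (q ≟ x)))
      ≡⟨ ∑-distrib-+ (allFin n) _ _ ⟩
    ∑[ q < n ] 𝟙 (does (v ≟ x) ∧ does (q ≟ y)) + ∑[ q < n ] 𝟙 (does (v ≟ y) ∧ does (q ≟ x))
      ≡⟨ cong₂ _+_ (∑<-𝟙-∧-≟ (does (v ≟ x)) y) (∑<-𝟙-∧-≟ (does (v ≟ y)) x) ⟩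
    𝟙 (does (v ≟ x)) + 𝟙 (does (v ≟ y)) ∎
    where open ≡-Reasoning

  ∑-pair-∨-row : ∀ {x y a b} → x ≢ y → a ≢ b → a ≢ x → a ≢ y → ∀ v
    → ∑[ q < n ] 𝟙 (pair x y v q ∨ pair a b v q)
      ≡ (𝟙 (does (v ≟ x)) + 𝟙 (does (v ≟ y))) + (𝟙 (does (v ≟ a)) + 𝟙 (does (v ≟ b)))
  ∑-pair-∨-row {x} {y} {a} {b} x≢y a≢b a≢x a≢y v = begin
    ∑[ q < n ] 𝟙 (pair x y v q ∨ pair a b v q)
      ≡⟨ ∑-cong (allFin n) (λ q →
           𝟙-∨ (pair x y v q) (pair a b v q) (pairs-disjoint {x} {y} {a} {b} a≢x a≢y v q)) ⟩
    ∑[ q < n ] (𝟙 (pair x y v q) + 𝟙 (pair a b v q))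
      ≡⟨ ∑-distrib-+ (allFin n) _ _ ⟩
    ∑[ q < n ] 𝟙 (pair x y v q) + ∑[ q < n ] 𝟙 (pair a b v q)
      ≡⟨ cong₂ _+_ (∑-pair-row x≢y v) (∑-pair-row a≢b v) ⟩
    (𝟙 (does (v ≟ x)) + 𝟙 (does (v ≟ y))) + (𝟙 (does (v ≟ a)) + 𝟙 (does (v ≟ b))) ∎
    where open ≡-Reasoning

  ∑∑-<ᶠ-symmetrize-≤ : ∀ (g : Fin n → Fin n → ℕ)
    → ∑[ p < n ] ∑[ q < n ] (𝟙 (p <ᶠ q) * (g p q + g q p)) ≤ ∑[ p < n ] ∑[ q < n ] g p q
  ∑∑-<ᶠ-symmetrize-≤ g = begin
    ∑[ p < n ] ∑[ q < n ] (𝟙 (p <ᶠ q) * (g p q + g q p))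
      ≡⟨ ∑-cong (allFin n) (λ p → trans (∑-cong (allFin n) (λ q → *-distribˡ-+ (𝟙 (p <ᶠ q)) (g p q) (g q p)))
                                        (∑-distrib-+ (allFin n) _ _)) ⟩
    ∑[ p < n ] (∑[ q < n ] (𝟙 (p <ᶠ q) * g p q) + ∑[ q < n ] (𝟙 (p <ᶠ q) * g q p))
      ≡⟨ ∑-distrib-+ (allFin n) _ _ ⟩
    ∑[ p < n ] ∑[ q < n ] (𝟙 (p <ᶠ q) * g p q) + ∑[ p < n ] ∑[ q < n ] (𝟙 (p <ᶠ q) * g q p)
      ≡⟨ cong (∑[ p < n ] ∑[ q < n ] (𝟙 (p <ᶠ q) * g p q) +_) (∑-comm (allFin n) (allFin n) _) ⟩
    ∑[ p < n ] ∑[ q < n ] (𝟙 (p <ᶠ q) * g p q) + ∑[ p < n ] ∑[ q < n ] (𝟙 (q <ᶠ p) * g p q)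
      ≡⟨ sym (∑-distrib-+ (allFin n) _ _) ⟩
    ∑[ p < n ] (∑[ q < n ] (𝟙 (p <ᶠ q) * g p q) + ∑[ q < n ] (𝟙 (q <ᶠ p) * g p q))
      ≡⟨ ∑-cong (allFin n) (λ p → trans (sym (∑-distrib-+ (allFin n) _ _))
                                        (∑-cong (allFin n) (λ q → sym (*-distribʳ-+ (g p q) (𝟙 (p <ᶠ q)) _)))) ⟩
    ∑[ p < n ] ∑[ q < n ] ((𝟙 (p <ᶠ q) + 𝟙 (q <ᶠ p)) * g p q)
      ≤⟨ ∑-mono (allFin n) (λ p → ∑-mono (allFin n) (λ q →
           ≤-trans (*-monoˡ-≤ (g p q) (𝟙-<ᵇ-asym (toℕ p) (toℕ q))) (≤-reflexive (*-identityˡ (g p q))))) ⟩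
    ∑[ p < n ] ∑[ q < n ] g p q ∎
    where
    open ≤-Reasoning

  ∑∑-<ᶠ-pair : ∀ {x y} → x ≢ y → ∑[ p < n ] ∑[ q < n ] 𝟙 (p <ᶠ q ∧ pair x y p q) ≡ 1
  ∑∑-<ᶠ-pair {x} {y} x≢y = begin
    ∑[ p < n ] ∑[ q < n ] 𝟙 (p <ᶠ q ∧ pair x y p q)
      ≡⟨ ∑-cong (allFin n) (λ p → ∑-cong (allFin n) (expand p)) ⟩
    ∑[ p < n ] ∑[ q < n ] (𝟙 (does (p ≟ x)) * (𝟙 (does (q ≟ y)) * 𝟙 (p <ᶠ q))
                          + 𝟙 (does (p ≟ y)) * (𝟙 (does (q ≟ x)) * 𝟙 (p <ᶠ q)))
      ≡⟨ ∑-cong (allFin n) sum-q ⟩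
    ∑[ p < n ] (𝟙 (does (p ≟ x)) * 𝟙 (p <ᶠ y) + 𝟙 (does (p ≟ y)) * 𝟙 (p <ᶠ x))
      ≡⟨ ∑-distrib-+ (allFin n) _ _ ⟩
    ∑[ p < n ] (𝟙 (does (p ≟ x)) * 𝟙 (p <ᶠ y)) + ∑[ p < n ] (𝟙 (does (p ≟ y)) * 𝟙 (p <ᶠ x))
      ≡⟨ cong₂ _+_ (∑<-pointMass x (λ p → 𝟙 (p <ᶠ y))) (∑<-pointMass y (λ p → 𝟙 (p <ᶠ x))) ⟩
    𝟙 (x <ᶠ y) + 𝟙 (y <ᶠ x)
      ≡⟨ 𝟙-<ᵇ-total (toℕ x) (toℕ y) (x≢y ∘ toℕ-injective) ⟩
    1 ∎
    where
    open ≡-Reasoning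
    spread : ∀ l a b c e → l * (a * b + c * e) ≡ a * (b * l) + c * (e * l)
    spread = solve-∀
    expand : ∀ p q → 𝟙 (p <ᶠ q ∧ pair x y p q)
      ≡ 𝟙 (does (p ≟ x)) * (𝟙 (does (q ≟ y)) * 𝟙 (p <ᶠ q))
        + 𝟙 (does (p ≟ y)) * (𝟙 (does (q ≟ x)) * 𝟙 (p <ᶠ q))
    expand p q = begin
      𝟙 (p <ᶠ q ∧ pair x y p q)
        ≡⟨ trans (𝟙-∧ (p <ᶠ q) _) (cong (𝟙 (p <ᶠ q) *_) (𝟙-pair x≢y p q)) ⟩
      𝟙 (p <ᶠ q) * (𝟙 (does (p ≟ x) ∧ does (q ≟ y)) + 𝟙 (does (p ≟ y) ∧ does (q ≟ x)))
        ≡⟨ cong (𝟙 (p <ᶠ q) *_) (cong₂ _+_ (𝟙-∧ (does (p ≟ x)) _) (𝟙-∧ (does (p ≟ y)) _)) ⟩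
      𝟙 (p <ᶠ q) * (𝟙 (does (p ≟ x)) * 𝟙 (does (q ≟ y)) + 𝟙 (does (p ≟ y)) * 𝟙 (does (q ≟ x)))
        ≡⟨ spread (𝟙 (p <ᶠ q)) (𝟙 (does (p ≟ x))) (𝟙 (does (q ≟ y)))
                                (𝟙 (does (p ≟ y))) (𝟙 (does (q ≟ x))) ⟩
      _ ∎
    sum-q : ∀ p → ∑[ q < n ] (𝟙 (does (p ≟ x)) * (𝟙 (does (q ≟ y)) * 𝟙 (p <ᶠ q))
                             + 𝟙 (does (p ≟ y)) * (𝟙 (does (q ≟ x)) * 𝟙 (p <ᶠ q)))
                 ≡ 𝟙 (does (p ≟ x)) * 𝟙 (p <ᶠ y) + 𝟙 (does (p ≟ y)) * 𝟙 (p <ᶠ x)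
    sum-q p = trans (∑-distrib-+ (allFin n) _ _) (cong₂ _+_
      (trans (∑-*ˡ (allFin n) (𝟙 (does (p ≟ x))) _)
             (cong (𝟙 (does (p ≟ x)) *_) (∑<-pointMass y (λ q → 𝟙 (p <ᶠ q)))))
      (trans (∑-*ˡ (allFin n) (𝟙 (does (p ≟ y))) _)
             (cong (𝟙 (does (p ≟ y)) *_) (∑<-pointMass x (λ q → 𝟙 (p <ᶠ q))))))

-- Switchings

𝟙-xor-∨ : ∀ a r s → (T r → a ≡ true) → (T s → a ≡ false) → 𝟙 (a xor (r ∨ s)) + 𝟙 r ≡ 𝟙 a + 𝟙 s
𝟙-xor-∨ true  true  false _   _    = refl
𝟙-xor-∨ true  false false _   _    = refl
𝟙-xor-∨ true  _     true  _   s⇒¬a = case s⇒¬a _ of λ ()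
𝟙-xor-∨ false true  _     r⇒a _    = case r⇒a _ of λ ()
𝟙-xor-∨ false false true  _   _    = refl
𝟙-xor-∨ false false false _   _    = refl

-- Of the toggled pairs r₀ ∨ r₁ ∨ s only r₀ (the edge xy) lies between U and W.
𝟙-xor-∨-∧ : ∀ l a u r₀ r₁ s
  → (T r₀ → a ≡ true) → (T r₀ → u ≡ true) → (T r₁ → u ≡ false) → (T s → u ≡ false)
  → 𝟙 (l ∧ (a xor ((r₀ ∨ r₁) ∨ s)) ∧ u) + 𝟙 (l ∧ r₀) ≡ 𝟙 (l ∧ a ∧ u)
𝟙-xor-∨-∧ false _     _     _     _     _     _   _   _    _    = refl
𝟙-xor-∨-∧ true  _     false true  _     _     _   r⇒u _    _    = case r⇒u _ of λ ()
𝟙-xor-∨-∧ true  a     false false r₁    s     _   _   _    _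
  rewrite ∧-zeroʳ (a xor (r₁ ∨ s)) | ∧-zeroʳ a = refl
𝟙-xor-∨-∧ true  _     true  _     true  _     _   _   r⇒¬u _    = case r⇒¬u _ of λ ()
𝟙-xor-∨-∧ true  _     true  _     false true  _   _   _    s⇒¬u = case s⇒¬u _ of λ ()
𝟙-xor-∨-∧ true  true  true  true  false false _   _   _    _    = refl
𝟙-xor-∨-∧ true  false true  true  false false r⇒a _   _    _    = case r⇒a _ of λ ()
𝟙-xor-∨-∧ true  true  true  false false false _   _   _    _    = refl
𝟙-xor-∨-∧ true  false true  false false false _   _   _    _    = refl

module _ {n : ℕ} where

  removed added switchedPairs : (x y a b : Fin n) → Fin n → Fin n → Bool
  removed x y a b p q = pair x y p q ∨ pair a b p q
  added   x y a b p q = pair x a p q ∨ pair y b p q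
  switchedPairs x y a b p q = removed x y a b p q ∨ added x y a b p q

  -- Toggling all four pairs at once: the inverse switching (x, a, y, b) toggles the same pairs,
  -- which makes switching an involution on all matrices.
  switch : AdjMatrix n → (x y a b : Fin n) → AdjMatrix n
  switch M x y a b = fromFun (λ p q → adj M p q xor switchedPairs x y a b p q)

  switch-involutive : ∀ M x y a b → switch (switch M x y a b) x a y b ≡ M
  switch-involutive M x y a b = adj-ext λ p q → let Δ = switchedPairs x y a b p q in begin
    adj (switch (switch M x y a b) x a y b) p q
      ≡⟨ adj-fromFun _ p q ⟩
    adj (switch M x y a b) p q xor switchedPairs x a y b p q
      ≡⟨ cong₂ _xor_ (adj-fromFun _ p q) (∨-comm (added x y a b p q) _) ⟩
    (adj M p q xor Δ) xor Δ ≡⟨ xor-assoc (adj M p q) Δ Δ ⟩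
    adj M p q xor (Δ xor Δ) ≡⟨ cong (adj M p q xor_) (xor-same Δ) ⟩
    adj M p q xor false     ≡⟨ xor-identityʳ (adj M p q) ⟩
    adj M p q               ∎
    where open ≡-Reasoning

  record Switchable (d : ℕ) (U W : Subset n) (M : AdjMatrix n) (x y a b : Fin n) : Set where
    field
      regular : IsRegular d M
      xy∈M    : adj M x y ≡ true
      ab∈M    : adj M a b ≡ true
      xa∉M    : adj M x a ≡ false
      yb∉M    : adj M y b ≡ false
      x∈U     : lookup U x ≡ true
      y∈W     : lookup W y ≡ true
      a∉U     : lookup U a ≡ false
      a∉W     : lookup W a ≡ false
      b∉U     : lookup U b ≡ false
      b∉W     : lookup W b ≡ false
      a≢x     : a ≢ x
      a≢y     : a ≢ y
      b≢x     : b ≢ x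
      b≢y     : b ≢ y

  module Switching {d U W M x y a b} (sw : Switchable d U W M x y a b) where
    open Switchable sw
    open IsRegular regular

    M′ : AdjMatrix n
    M′ = switch M x y a b

    adj-M′ : ∀ p q → adj M′ p q ≡ adj M p q xor switchedPairs x y a b p q
    adj-M′ = adj-fromFun _

    non-loop : ∀ {u v} → adj M u v ≡ true → u ≢ v
    non-loop {u} uv∈M refl = case trans (sym (irreflexive u)) uv∈M of λ ()

    x≢y : x ≢ y
    x≢y = non-loop xy∈M

    a≢b : a ≢ b
    a≢b = non-loop ab∈M

    xy-between : between U W x y ≡ true
    xy-between rewrite x∈U | y∈W = refl

    ab-between : between U W a b ≡ false
    ab-between = between-∉ˡ U W a∉U a∉W b

    xa-between : between U W x a ≡ false
    xa-between = between-∉ʳ U W a∉U a∉W x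

    yb-between : between U W y b ≡ false
    yb-between = between-∉ʳ U W b∉U b∉W y

    ∑-removed≡∑-added : ∀ v → ∑[ q < n ] 𝟙 (removed x y a b v q) ≡ ∑[ q < n ] 𝟙 (added x y a b v q)
    ∑-removed≡∑-added v = begin
      ∑[ q < n ] 𝟙 (removed x y a b v q)
        ≡⟨ ∑-pair-∨-row x≢y a≢b a≢x a≢y v ⟩
      (𝟙 (does (v ≟ x)) + 𝟙 (does (v ≟ y))) + (𝟙 (does (v ≟ a)) + 𝟙 (does (v ≟ b)))
        ≡⟨ interchange +-commutativeSemigroup (𝟙 (does (v ≟ x))) _ _ _ ⟩
      (𝟙 (does (v ≟ x)) + 𝟙 (does (v ≟ a))) + (𝟙 (does (v ≟ y)) + 𝟙 (does (v ≟ b)))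
        ≡⟨ sym (∑-pair-∨-row (a≢x ∘ sym) (b≢y ∘ sym) (x≢y ∘ sym) (a≢y ∘ sym) v) ⟩
      ∑[ q < n ] 𝟙 (added x y a b v q) ∎
      where open ≡-Reasoning

    switch-degree : ∀ v → ∑[ q < n ] 𝟙 (adj M′ v q) ≡ d
    switch-degree v = +-cancelʳ-≡ (∑[ q < n ] 𝟙 (added x y a b v q)) _ _ (begin
      ∑[ q < n ] 𝟙 (adj M′ v q) + ∑[ q < n ] 𝟙 (added x y a b v q)
        ≡⟨ cong₂ _+_ (∑-cong (allFin n) (cong 𝟙 ∘ adj-M′ v)) (sym (∑-removed≡∑-added v)) ⟩
      ∑[ q < n ] 𝟙 (adj M v q xor switchedPairs x y a b v q) + ∑[ q < n ] 𝟙 (removed x y a b v q)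
        ≡⟨ sym (∑-distrib-+ (allFin n) _ _) ⟩
      ∑[ q < n ] (𝟙 (adj M v q xor switchedPairs x y a b v q) + 𝟙 (removed x y a b v q))
        ≡⟨ ∑-cong (allFin n) (λ q → 𝟙-xor-∨ (adj M v q) _ _
             (pair-∨-value (adj M) symmetric xy∈M ab∈M) (pair-∨-value (adj M) symmetric xa∉M yb∉M)) ⟩
      ∑[ q < n ] (𝟙 (adj M v q) + 𝟙 (added x y a b v q))
        ≡⟨ ∑-distrib-+ (allFin n) _ _ ⟩
      ∑[ q < n ] 𝟙 (adj M v q) + ∑[ q < n ] 𝟙 (added x y a b v q)
        ≡⟨ cong (_+ _) (degree-≡ v) ⟩
      d + ∑[ q < n ] 𝟙 (added x y a b v q) ∎)
      where open ≡-Reasoning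

    switch-isRegular : IsRegular d M′
    switch-isRegular = record
      { symmetric   = λ p q → trans (adj-M′ p q)
                                      (trans (cong₂ _xor_ (symmetric p q) (switchedPairs-sym p q)) (sym (adj-M′ q p)))
      ; irreflexive = λ p → trans (adj-M′ p p) (cong₂ _xor_ (irreflexive p) (switchedPairs-diagonal p))
      ; degree-≡    = switch-degree
      }
      where
      switchedPairs-sym : ∀ p q → switchedPairs x y a b p q ≡ switchedPairs x y a b q p
      switchedPairs-sym p q = cong₂ _∨_ (cong₂ _∨_ (pair-sym x y p q) (pair-sym a b p q))
                                        (cong₂ _∨_ (pair-sym x a p q) (pair-sym y b p q))
      switchedPairs-diagonal : ∀ p → switchedPairs x y a b p p ≡ false
      switchedPairs-diagonal p = cong₂ _∨_ (cong₂ _∨_ (pair-diagonal x≢y p) (pair-diagonal a≢b p))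
                                           (cong₂ _∨_ (pair-diagonal (a≢x ∘ sym) p) (pair-diagonal (b≢y ∘ sym) p))

    switch-edgesBetween : edgesBetween U W M ≡ suc (edgesBetween U W M′)
    switch-edgesBetween = begin
      edgesBetween U W M
        ≡⟨ edgesBetween≡∑ U W M ⟩
      ∑[ p < n ] ∑[ q < n ] 𝟙 (p <ᶠ q ∧ adj M p q ∧ between U W p q)
        ≡⟨ ∑-cong (allFin n) (λ p → ∑-cong (allFin n) (λ q → sym (removes-xy p q))) ⟩
      ∑[ p < n ] ∑[ q < n ] (𝟙 (p <ᶠ q ∧ adj M′ p q ∧ between U W p q) + 𝟙 (p <ᶠ q ∧ pair x y p q))
        ≡⟨ trans (∑-cong (allFin n) (λ p → ∑-distrib-+ (allFin n) _ _)) (∑-distrib-+ (allFin n) _ _) ⟩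
      ∑[ p < n ] ∑[ q < n ] 𝟙 (p <ᶠ q ∧ adj M′ p q ∧ between U W p q)
        + ∑[ p < n ] ∑[ q < n ] 𝟙 (p <ᶠ q ∧ pair x y p q)
        ≡⟨ cong₂ _+_ (sym (edgesBetween≡∑ U W M′)) (∑∑-<ᶠ-pair x≢y) ⟩
      edgesBetween U W M′ + 1
        ≡⟨ +-comm _ 1 ⟩
      suc (edgesBetween U W M′) ∎
      where
      open ≡-Reasoning
      removes-xy : ∀ p q → 𝟙 (p <ᶠ q ∧ adj M′ p q ∧ between U W p q) + 𝟙 (p <ᶠ q ∧ pair x y p q)
                           ≡ 𝟙 (p <ᶠ q ∧ adj M p q ∧ between U W p q)
      removes-xy p q rewrite adj-M′ p q = 𝟙-xor-∨-∧ (p <ᶠ q) (adj M p q) (between U W p q) _ _ _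
        (pair-value (adj M) symmetric xy∈M)
        (pair-value (between U W) (between-sym U W) xy-between)
        (pair-value (between U W) (between-sym U W) ab-between)
        (pair-∨-value (between U W) (between-sym U W) xa-between yb-between)

    added⇒M′ : ∀ {p q} → T (added x y a b p q) → adj M′ p q ≡ true
    added⇒M′ {p} {q} t = trans (adj-M′ p q) (cong₂ _xor_
      (pair-∨-value (adj M) symmetric xa∉M yb∉M t)
      (T⇒≡true (Equivalence.from (T-∨ {removed x y a b p q}) (inj₂ t))))

    xa∈M′ : adj M′ x a ≡ true
    xa∈M′ = added⇒M′ (Equivalence.from (T-∨ {pair x a x a}) (inj₁ (pair-refl x a)))

    yb∈M′ : adj M′ y b ≡ true
    yb∈M′ = added⇒M′ (Equivalence.from (T-∨ {pair x a y b}) (inj₂ (pair-refl y b)))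

-- Counting forward and backward switchings

Quadruple : ℕ → Set
Quadruple n = Fin n × Fin n × Fin n × Fin n

quadruples : ∀ n → List (Quadruple n)
quadruples n = cartesianProduct (allFin n) (cartesianProduct (allFin n) (cartesianProduct (allFin n) (allFin n)))

∑-quadruples : ∀ n (f : Quadruple n → ℕ)
  → ∑ (quadruples n) f ≡ ∑[ x < n ] ∑[ y < n ] ∑[ a < n ] ∑[ b < n ] f (x , y , a , b)
∑-quadruples n f =
  trans (∑-cartesianProduct (allFin n) _ f) (∑-cong (allFin n) λ x →
  trans (∑-cartesianProduct (allFin n) _ _) (∑-cong (allFin n) λ y →
  ∑-cartesianProduct (allFin n) (allFin n) _))

𝟙-split-≤ : ∀ a b₁ b₂ → 𝟙 a ≤ 𝟙 (a ∧ not (b₁ ∨ b₂)) + (𝟙 b₁ + 𝟙 b₂) * 𝟙 a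
𝟙-split-≤ false _     _     = z≤n
𝟙-split-≤ true  true  _     = s≤s z≤n
𝟙-split-≤ true  false true  = s≤s z≤n
𝟙-split-≤ true  false false = s≤s z≤n

𝟙-∧-∨-≤ : ∀ a c w₁ u₂ → 𝟙 (a ∧ (c ∨ (w₁ ∧ u₂))) ≤ 𝟙 (a ∧ c) + 𝟙 (a ∧ (u₂ ∧ w₁))
𝟙-∧-∨-≤ false _ _  _  = z≤n
𝟙-∧-∨-≤ true  c w₁ u₂ =
  subst (λ e → 𝟙 (c ∨ (w₁ ∧ u₂)) ≤ 𝟙 c + 𝟙 e) (Bool.∧-comm w₁ u₂) (𝟙-∨-≤ c _)

free-count⇒ : ∀ n d G β → n * d ≤ G + 2 * β * d → 4 * β < n → 1 ≤ d → d * n + 1 ≤ 2 * G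
free-count⇒ n d G β nd≤G+2βd 4β<n 1≤d = +-cancelʳ-≤ (4 * β * d) (d * n + 1) (2 * G) (begin
  d * n + 1 + 4 * β * d   ≤⟨ +-monoˡ-≤ (4 * β * d) (+-monoʳ-≤ (d * n) 1≤d) ⟩
  d * n + d + 4 * β * d   ≡⟨ e₁ n d β ⟩
  d * n + suc (4 * β) * d ≤⟨ +-monoʳ-≤ (d * n) (*-monoˡ-≤ d 4β<n) ⟩
  d * n + n * d           ≡⟨ e₂ n d ⟩
  2 * (n * d)             ≤⟨ *-monoʳ-≤ 2 nd≤G+2βd ⟩
  2 * (G + 2 * β * d)     ≡⟨ e₃ G β d ⟩
  2 * G + 4 * β * d       ∎)
  where
  open ≤-Reasoning
  e₁ : ∀ n d β → d * n + d + 4 * β * d ≡ d * n + suc (4 * β) * d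
  e₁ = solve-∀
  e₂ : ∀ n d → d * n + n * d ≡ 2 * (n * d)
  e₂ = solve-∀
  e₃ : ∀ G β d → 2 * (G + 2 * β * d) ≡ 2 * G + 4 * β * d
  e₃ = solve-∀

module Counting {n : ℕ} (U W : Subset n) where

  blocked : AdjMatrix n → (x y a : Fin n) → Bool
  blocked M x y a = lookup U a ∨ lookup W a ∨ adj M x a ∨ does (a ≟ x) ∨ does (a ≟ y)

  crossing : AdjMatrix n → Fin n → Fin n → Bool
  crossing M x y = adj M x y ∧ (lookup U x ∧ lookup W y)

  free : AdjMatrix n → (x y a b : Fin n) → Bool
  free M x y a b = adj M a b ∧ not (blocked M x y a ∨ blocked M y x b)

  forward backward : AdjMatrix n → Quadruple n → Bool
  forward  M (x , y , a , b) = crossing M x y ∧ free M x y a b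
  backward M (x , y , a , b) = (lookup U x ∧ adj M x a) ∧ (lookup W y ∧ adj M y b)

  unblocked : ∀ {M x y a} → blocked M x y a ≡ false
    → lookup U a ≡ false × lookup W a ≡ false × adj M x a ≡ false × a ≢ x × a ≢ y
  unblocked {M} {x} {y} {a} h =
    ∨-conicalˡ _ _ h , ∨-conicalˡ _ _ h₁ , ∨-conicalˡ _ _ h₂
    , does≡false⇒≢ (∨-conicalˡ _ _ h₃) , does≡false⇒≢ (∨-conicalʳ _ _ h₃)
    where
    h₁ : lookup W a ∨ adj M x a ∨ does (a ≟ x) ∨ does (a ≟ y) ≡ false
    h₁ = ∨-conicalʳ (lookup U a) _ h
    h₂ : adj M x a ∨ does (a ≟ x) ∨ does (a ≟ y) ≡ false
    h₂ = ∨-conicalʳ (lookup W a) _ h₁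
    h₃ : does (a ≟ x) ∨ does (a ≟ y) ≡ false
    h₃ = ∨-conicalʳ (adj M x a) _ h₂

  forward⇒Switchable : ∀ {d M x y a b} → IsRegular d M → T (forward M (x , y , a , b)) → Switchable d U W M x y a b
  forward⇒Switchable {M = M} {x} {y} {a} {b} reg t =
    let a∉U , a∉W , xa∉M , a≢x , a≢y = unblocked {M} (∨-conicalˡ _ _ unblocked-ab)
        b∉U , b∉W , yb∉M , b≢y , b≢x = unblocked {M} (∨-conicalʳ (blocked M x y a) _ unblocked-ab)
    in record
    { regular = reg
    ; xy∈M = ∧-conicalˡ _ _ crossing-xy
    ; ab∈M = ∧-conicalˡ _ _ free-ab
    ; xa∉M = xa∉M ; yb∉M = yb∉M
    ; x∈U  = ∧-conicalˡ _ _ UW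
    ; y∈W  = ∧-conicalʳ (lookup U x) _ UW
    ; a∉U = a∉U ; a∉W = a∉W ; b∉U = b∉U ; b∉W = b∉W
    ; a≢x = a≢x ; a≢y = a≢y ; b≢x = b≢x ; b≢y = b≢y
    }
    where
    crossing-xy : crossing M x y ≡ true
    crossing-xy = ∧-conicalˡ _ _ (T⇒≡true t)
    free-ab : free M x y a b ≡ true
    free-ab = ∧-conicalʳ (crossing M x y) _ (T⇒≡true t)
    UW : lookup U x ∧ lookup W y ≡ true
    UW = ∧-conicalʳ (adj M x y) _ crossing-xy
    unblocked-ab : blocked M x y a ∨ blocked M y x b ≡ false
    unblocked-ab = not-injective (∧-conicalʳ (adj M a b) _ free-ab)

  module _ {d} {M : AdjMatrix n} (reg : IsRegular d M) where
    open IsRegular reg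

    ∑-adj-row : ∀ c x → ∑[ a < n ] 𝟙 (c ∧ adj M x a) ≡ 𝟙 c * d
    ∑-adj-row c x =
      trans (∑-cong (allFin n) (λ a → 𝟙-∧ c _)) (trans (∑-*ˡ (allFin n) (𝟙 c) _) (cong (𝟙 c *_) (degree-≡ x)))

    ∑∑-𝟙-*-adj-row : ∀ (c : Fin n → Bool)
      → ∑[ a < n ] ∑[ b < n ] (𝟙 (c a) * 𝟙 (adj M a b)) ≡ (∑[ a < n ] 𝟙 (c a)) * d
    ∑∑-𝟙-*-adj-row c = trans
      (∑-cong (allFin n) λ a → trans (∑-*ˡ (allFin n) (𝟙 (c a)) _) (cong (𝟙 (c a) *_) (degree-≡ a)))
      (∑-*ʳ (allFin n) d _)

    ∑∑-𝟙-*-adj-column : ∀ (c : Fin n → Bool)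
      → ∑[ a < n ] ∑[ b < n ] (𝟙 (c b) * 𝟙 (adj M a b)) ≡ (∑[ b < n ] 𝟙 (c b)) * d
    ∑∑-𝟙-*-adj-column c = trans (∑-comm (allFin n) (allFin n) _)
      (trans (∑-cong (allFin n) λ b → ∑-cong (allFin n) λ a → cong (λ e → 𝟙 (c b) * 𝟙 e) (symmetric a b))
             (∑∑-𝟙-*-adj-row c))

    blocked-count : ∀ x y → ∑[ a < n ] 𝟙 (blocked M x y a) ≤ ∣ U ∣ + (∣ W ∣ + (d + 2))
    blocked-count x y = begin
      ∑[ a < n ] 𝟙 (blocked M x y a)
        ≤⟨ ∑-mono (allFin n) bound ⟩
      ∑[ a < n ] (u a + (w a + (e a + (δx a + δy a))))
        ≡⟨ ∑-distrib-+ (allFin n) u _ ⟩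
      ∑< n u + ∑[ a < n ] (w a + (e a + (δx a + δy a)))
        ≡⟨ cong (∑< n u +_) (∑-distrib-+ (allFin n) w _) ⟩
      ∑< n u + (∑< n w + ∑[ a < n ] (e a + (δx a + δy a)))
        ≡⟨ cong (λ s → ∑< n u + (∑< n w + s)) (∑-distrib-+ (allFin n) e _) ⟩
      ∑< n u + (∑< n w + (∑< n e + ∑[ a < n ] (δx a + δy a)))
        ≡⟨ cong (λ s → ∑< n u + (∑< n w + (∑< n e + s))) (∑-distrib-+ (allFin n) δx δy) ⟩
      ∑< n u + (∑< n w + (∑< n e + (∑< n δx + ∑< n δy)))
        ≡⟨ cong₂ _+_ (sym (∣∣≡∑ U)) (cong₂ _+_ (sym (∣∣≡∑ W))
             (cong₂ _+_ (degree-≡ x) (cong₂ _+_ (allFin-enumerates n x) (allFin-enumerates n y)))) ⟩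
      ∣ U ∣ + (∣ W ∣ + (d + 2)) ∎
      where
      open ≤-Reasoning
      u w e δx δy : Fin n → ℕ
      u  a = 𝟙 (lookup U a)
      w  a = 𝟙 (lookup W a)
      e  a = 𝟙 (adj M x a)
      δx a = 𝟙 (does (a ≟ x))
      δy a = 𝟙 (does (a ≟ y))
      bound : ∀ a → 𝟙 (blocked M x y a) ≤ u a + (w a + (e a + (δx a + δy a)))
      bound a =
        ≤-trans (𝟙-∨-≤ (lookup U a) _) (+-monoʳ-≤ (u a) (
        ≤-trans (𝟙-∨-≤ (lookup W a) _) (+-monoʳ-≤ (w a) (
        ≤-trans (𝟙-∨-≤ (adj M x a) _) (+-monoʳ-≤ (e a) (𝟙-∨-≤ (does (a ≟ x)) _))))))

    free-count : ∀ x y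
      → n * d ≤ (∑[ a < n ] ∑[ b < n ] 𝟙 (free M x y a b)) + 2 * (∣ U ∣ + (∣ W ∣ + (d + 2))) * d
    free-count x y = begin
      n * d
        ≡⟨ sym (trans (∑-cong (allFin n) degree-≡)
                      (trans (∑-const (allFin n) d) (cong (_* d) (length-tabulate {n = n} (λ a → a))))) ⟩
      ∑[ a < n ] ∑[ b < n ] 𝟙 (adj M a b)
        ≤⟨ ∑-mono (allFin n) (λ a → ∑-mono (allFin n) (λ b → 𝟙-split-≤ (adj M a b) (Bx a) (By b))) ⟩
      ∑[ a < n ] ∑[ b < n ] (𝟙 (free M x y a b) + (𝟙 (Bx a) + 𝟙 (By b)) * 𝟙 (adj M a b))
        ≡⟨ trans (∑-cong (allFin n) (λ a → ∑-distrib-+ (allFin n) _ _)) (∑-distrib-+ (allFin n) _ _) ⟩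
      G + ∑[ a < n ] ∑[ b < n ] ((𝟙 (Bx a) + 𝟙 (By b)) * 𝟙 (adj M a b))
        ≡⟨ cong (G +_) (trans (∑-cong (allFin n) λ a → trans
                                 (∑-cong (allFin n) λ b → *-distribʳ-+ (𝟙 (adj M a b)) (𝟙 (Bx a)) (𝟙 (By b)))
                                 (∑-distrib-+ (allFin n) _ _))
                              (∑-distrib-+ (allFin n) _ _)) ⟩
      G + (∑[ a < n ] ∑[ b < n ] (𝟙 (Bx a) * 𝟙 (adj M a b)) + ∑[ a < n ] ∑[ b < n ] (𝟙 (By b) * 𝟙 (adj M a b)))
        ≡⟨ cong (G +_) (cong₂ _+_ (∑∑-𝟙-*-adj-row Bx) (∑∑-𝟙-*-adj-column By)) ⟩
      G + ((∑[ a < n ] 𝟙 (Bx a)) * d + (∑[ b < n ] 𝟙 (By b)) * d)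
        ≤⟨ +-monoʳ-≤ G (+-mono-≤ (*-monoˡ-≤ d (blocked-count x y)) (*-monoˡ-≤ d (blocked-count y x))) ⟩
      G + (β * d + β * d)
        ≡⟨ cong (G +_) (twice β d) ⟩
      G + 2 * β * d ∎
      where
      open ≤-Reasoning
      Bx By : Fin n → Bool
      Bx = blocked M x y
      By = blocked M y x
      G = ∑[ a < n ] ∑[ b < n ] 𝟙 (free M x y a b)
      β = ∣ U ∣ + (∣ W ∣ + (d + 2))
      twice : ∀ k e → k * e + k * e ≡ 2 * k * e
      twice = solve-∀

    edgesBetween≤crossings : edgesBetween U W M ≤ ∑[ x < n ] ∑[ y < n ] 𝟙 (crossing M x y)
    edgesBetween≤crossings = begin
      edgesBetween U W M
        ≡⟨ edgesBetween≡∑ U W M ⟩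
      ∑[ p < n ] ∑[ q < n ] 𝟙 (p <ᶠ q ∧ adj M p q ∧ between U W p q)
        ≡⟨ ∑-cong (allFin n) (λ p → ∑-cong (allFin n) (λ q → 𝟙-∧ (p <ᶠ q) _)) ⟩
      ∑[ p < n ] ∑[ q < n ] (𝟙 (p <ᶠ q) * 𝟙 (adj M p q ∧ between U W p q))
        ≤⟨ ∑-mono (allFin n) (λ p → ∑-mono (allFin n) (λ q → *-monoʳ-≤ (𝟙 (p <ᶠ q)) (bound p q))) ⟩
      ∑[ p < n ] ∑[ q < n ] (𝟙 (p <ᶠ q) * (𝟙 (crossing M p q) + 𝟙 (crossing M q p)))
        ≤⟨ ∑∑-<ᶠ-symmetrize-≤ (λ p q → 𝟙 (crossing M p q)) ⟩
      ∑[ x < n ] ∑[ y < n ] 𝟙 (crossing M x y) ∎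
      where
      open ≤-Reasoning
      bound : ∀ p q → 𝟙 (adj M p q ∧ between U W p q) ≤ 𝟙 (crossing M p q) + 𝟙 (crossing M q p)
      bound p q =
        subst (λ e → 𝟙 (adj M p q ∧ between U W p q) ≤ 𝟙 (crossing M p q) + 𝟙 (e ∧ (lookup U q ∧ lookup W p)))
              (symmetric p q)
              (𝟙-∧-∨-≤ (adj M p q) (lookup U p ∧ lookup W q) (lookup W p) (lookup U q))

    crossing⇒1≤d : ∀ {x y} → T (crossing M x y) → 1 ≤ d
    crossing⇒1≤d {x} {y} t = subst (1 ≤_) (degree-≡ x)
      (subst (_≤ ∑[ q < n ] 𝟙 (adj M x q)) (cong 𝟙 (∧-conicalˡ _ _ (T⇒≡true t)))
             (f≤∑ (𝟙 ∘ adj M x) (∈-allFin y)))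

    forward-count : 4 * (∣ U ∣ + (∣ W ∣ + (d + 2))) < n
      → edgesBetween U W M * (d * n + 1) ≤ 2 * ∑[ t ∈ quadruples n ] 𝟙 (forward M t)
    forward-count 4β<n = begin
      edgesBetween U W M * (d * n + 1)
        ≤⟨ *-monoˡ-≤ (d * n + 1) edgesBetween≤crossings ⟩
      (∑[ x < n ] ∑[ y < n ] 𝟙 (crossing M x y)) * (d * n + 1)
        ≡⟨ sym (trans (∑-cong (allFin n) (λ x → ∑-*ʳ (allFin n) (d * n + 1) _))
                      (∑-*ʳ (allFin n) (d * n + 1) _)) ⟩
      ∑[ x < n ] ∑[ y < n ] (𝟙 (crossing M x y) * (d * n + 1))
        ≤⟨ ∑-mono (allFin n) (λ x → ∑-mono (allFin n) (λ y → 𝟙-*-mono (crossing M x y) (λ t →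
             free-count⇒ n d (G x y) (∣ U ∣ + (∣ W ∣ + (d + 2))) (free-count x y) 4β<n (crossing⇒1≤d t)))) ⟩
      ∑[ x < n ] ∑[ y < n ] (𝟙 (crossing M x y) * (2 * G x y))
        ≡⟨ trans (∑-cong (allFin n) (λ x → trans
                   (∑-cong (allFin n) (λ y → *-comm-2 (𝟙 (crossing M x y)) (G x y)))
                   (∑-*ˡ (allFin n) 2 _)))
                 (∑-*ˡ (allFin n) 2 _) ⟩
      2 * ∑[ x < n ] ∑[ y < n ] (𝟙 (crossing M x y) * G x y)
        ≡⟨ cong (2 *_) (sym ∑-forward) ⟩
      2 * ∑[ t ∈ quadruples n ] 𝟙 (forward M t) ∎
      where
      open ≤-Reasoning
      G : Fin n → Fin n → ℕ
      G x y = ∑[ a < n ] ∑[ b < n ] 𝟙 (free M x y a b)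
      *-comm-2 : ∀ c g → c * (2 * g) ≡ 2 * (c * g)
      *-comm-2 = solve-∀
      ∑-forward : ∑[ t ∈ quadruples n ] 𝟙 (forward M t) ≡ ∑[ x < n ] ∑[ y < n ] (𝟙 (crossing M x y) * G x y)
      ∑-forward = trans (∑-quadruples n _) (∑-cong (allFin n) λ x → ∑-cong (allFin n) λ y →
        trans (∑-cong (allFin n) (λ a → trans (∑-cong (allFin n) (λ b → 𝟙-∧ (crossing M x y) _))
                                              (∑-*ˡ (allFin n) (𝟙 (crossing M x y)) _)))
              (∑-*ˡ (allFin n) (𝟙 (crossing M x y)) _))

    backward-count : ∑[ t ∈ quadruples n ] 𝟙 (backward M t) ≡ ∣ U ∣ * d * (∣ W ∣ * d)
    backward-count = begin
      ∑[ t ∈ quadruples n ] 𝟙 (backward M t)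
        ≡⟨ ∑-quadruples n _ ⟩
      ∑[ x < n ] ∑[ y < n ] ∑[ a < n ] ∑[ b < n ] 𝟙 ((lookup U x ∧ adj M x a) ∧ (lookup W y ∧ adj M y b))
        ≡⟨ ∑-cong (allFin n) (λ x → ∑-cong (allFin n) (λ y → ∑-cong (allFin n) (λ a →
             trans (∑-cong (allFin n) (λ b → 𝟙-∧ (lookup U x ∧ adj M x a) _))
                   (trans (∑-*ˡ (allFin n) (𝟙 (lookup U x ∧ adj M x a)) _)
                          (cong (𝟙 (lookup U x ∧ adj M x a) *_) (∑-adj-row (lookup W y) y)))))) ⟩
      ∑[ x < n ] ∑[ y < n ] ∑[ a < n ] (𝟙 (lookup U x ∧ adj M x a) * (𝟙 (lookup W y) * d))
        ≡⟨ ∑-cong (allFin n) (λ x → ∑-cong (allFin n) (λ y →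
             trans (∑-*ʳ (allFin n) (𝟙 (lookup W y) * d) _)
                   (cong (_* (𝟙 (lookup W y) * d)) (∑-adj-row (lookup U x) x)))) ⟩
      ∑[ x < n ] ∑[ y < n ] (𝟙 (lookup U x) * d * (𝟙 (lookup W y) * d))
        ≡⟨ ∑-cong (allFin n) (λ x → trans (∑-*ˡ (allFin n) (𝟙 (lookup U x) * d) _)
                                          (cong (𝟙 (lookup U x) * d *_) (∑-𝟙-lookup-* W d))) ⟩
      ∑[ x < n ] (𝟙 (lookup U x) * d * (∣ W ∣ * d))
        ≡⟨ trans (∑-*ʳ (allFin n) (∣ W ∣ * d) _) (cong (_* (∣ W ∣ * d)) (∑-𝟙-lookup-* U d)) ⟩
      ∣ U ∣ * d * (∣ W ∣ * d) ∎
      where open ≡-Reasoning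

  Switchable⇒backward : ∀ {d M x y a b} → Switchable d U W M x y a b → T (backward (switch M x y a b) (x , y , a , b))
  Switchable⇒backward sw = Equivalence.from T-∧
    ( Equivalence.from T-∧ (≡true⇒T x∈U , ≡true⇒T xa∈M′)
    , Equivalence.from T-∧ (≡true⇒T y∈W , ≡true⇒T yb∈M′))
    where
    open Switchable sw
    open Switching sw

-- Double counting

switching-inequality : ∀ n d (U W : Subset n) i → 4 * (∣ U ∣ + (∣ W ∣ + (d + 2))) < n
  → numE n d U W (suc i) * (suc i * (d * n + 1)) ≤ 2 * (numE n d U W i * (∣ U ∣ * d * (∣ W ∣ * d)))
switching-inequality n d U W i 4β<n = begin
  numE n d U W (suc i) * X
    ≡⟨ trans (cong (_* X) (numE≡∑ n d U W (suc i))) (sym (∑-*ʳ ms X _)) ⟩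
  ∑[ M ∈ ms ] (𝟙 (E₁ M) * X)
    ≤⟨ ∑-mono ms (λ M → 𝟙-*-mono (E₁ M) (many-forward M)) ⟩
  ∑[ M ∈ ms ] (𝟙 (E₁ M) * (2 * F M))
    ≡⟨ trans (∑-cong ms (λ M → *-comm-2 (𝟙 (E₁ M)) (F M))) (∑-*ˡ ms 2 _) ⟩
  2 * ∑[ M ∈ ms ] (𝟙 (E₁ M) * F M)
    ≡⟨ cong (2 *_) (sym (∑∑-𝟙-∧ ms (quadruples n) E₁ forward)) ⟩
  2 * ∑[ t ∈ quadruples n ] ∑[ M ∈ ms ] 𝟙 (E₁ M ∧ forward M t)
    ≤⟨ *-monoʳ-≤ 2 (∑-mono (quadruples n) injection) ⟩
  2 * ∑[ t ∈ quadruples n ] ∑[ M ∈ ms ] 𝟙 (E₀ M ∧ backward M t)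
    ≡⟨ cong (2 *_) (∑∑-𝟙-∧ ms (quadruples n) E₀ backward) ⟩
  2 * ∑[ M ∈ ms ] (𝟙 (E₀ M) * ∑[ t ∈ quadruples n ] 𝟙 (backward M t))
    ≡⟨ cong (2 *_) (∑-cong ms (λ M → 𝟙-*-cong (E₀ M) (backward-count ∘ proj₁ ∘ 𝓔?-sound d U W i M))) ⟩
  2 * ∑[ M ∈ ms ] (𝟙 (E₀ M) * Y)
    ≡⟨ cong (2 *_) (trans (∑-*ʳ ms Y _) (cong (_* Y) (sym (numE≡∑ n d U W i)))) ⟩
  2 * (numE n d U W i * Y) ∎
  where
  open ≤-Reasoning
  open Counting U W
  ms = allMatrices n
  X = suc i * (d * n + 1)
  Y = ∣ U ∣ * d * (∣ W ∣ * d)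
  E₀ E₁ : AdjMatrix n → Bool
  E₀ = 𝓔? d U W i
  E₁ = 𝓔? d U W (suc i)
  F : AdjMatrix n → ℕ
  F M = ∑[ t ∈ quadruples n ] 𝟙 (forward M t)
  *-comm-2 : ∀ c g → c * (2 * g) ≡ 2 * (c * g)
  *-comm-2 = solve-∀
  many-forward : ∀ M → T (E₁ M) → X ≤ 2 * F M
  many-forward M t = let reg , e = 𝓔?-sound d U W (suc i) M t in
    subst (λ k → k * (d * n + 1) ≤ 2 * F M) e (forward-count reg 4β<n)
  injection : ∀ t → ∑[ M ∈ ms ] 𝟙 (E₁ M ∧ forward M t) ≤ ∑[ M ∈ ms ] 𝟙 (E₀ M ∧ backward M t)
  injection (x , y , a , b) = count-≤-by-retraction _≟ᴹ_ ms (allMatrices-enumerates n) _ _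
    (λ M → switch M x y a b) (λ M → switch M x a y b) switch-lands-in-E₀ (λ M _ → switch-involutive M x y a b)
    where
    switch-lands-in-E₀ : ∀ M → T (E₁ M ∧ forward M (x , y , a , b))
      → T (E₀ (switch M x y a b) ∧ backward (switch M x y a b) (x , y , a , b))
    switch-lands-in-E₀ M t =
      let inE₁ , fw = Equivalence.to (T-∧ {E₁ M}) t
          reg , e   = 𝓔?-sound d U W (suc i) M inE₁
          sw        = forward⇒Switchable reg fw
          open Switching sw
      in Equivalence.from (T-∧ {E₀ M′})
           ( 𝓔?-complete d U W i M′ switch-isRegular (suc-injective (trans (sym switch-edgesBetween) e))
           , Switchable⇒backward sw)

-- Arithmetic and the theorem

switching-ratio : ∀ E₁ E₀ i n d u w → 0 < E₁
  → E₁ * (suc i * (d * n + 1)) ≤ 2 * (E₀ * (u * d * (w * d)))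
  → E₁ * (suc i * n) < 2 * u * w * d * E₀
switching-ratio E₁ E₀ i n zero u w 0<E₁ le =
  case ≤-trans (*-mono-≤ 0<E₁ (s≤s z≤n)) (≤-trans le (≤-reflexive (e₀ E₀ u w))) of λ ()
  where
  e₀ : ∀ E₀ u w → 2 * (E₀ * (u * 0 * (w * 0))) ≡ 0
  e₀ = solve-∀
switching-ratio E₁ E₀ i n d@(suc _) u w 0<E₁ le = *-cancelʳ-< d _ _ (begin-strict
  E₁ * (suc i * n) * d              <⟨ m<m+n (E₁ * (suc i * n) * d) (*-mono-≤ 0<E₁ (s≤s z≤n)) ⟩
  E₁ * (suc i * n) * d + E₁ * suc i ≡⟨ e₁ E₁ i n d ⟩
  E₁ * (suc i * (d * n + 1))        ≤⟨ le ⟩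
  2 * (E₀ * (u * d * (w * d)))      ≡⟨ e₂ E₀ u w d ⟩
  2 * u * w * d * E₀ * d            ∎)
  where
  open ≤-Reasoning
  e₁ : ∀ E₁ i n d → E₁ * (suc i * n) * d + E₁ * suc i ≡ E₁ * (suc i * (d * n + 1))
  e₁ = solve-∀
  e₂ : ∀ E₀ u w d → 2 * (E₀ * (u * d * (w * d))) ≡ 2 * u * w * d * E₀ * d
  e₂ = solve-∀

ratio⇒decreasing : ∀ E₁ E₀ i n c → (0 < E₁ → E₁ * (suc i * n) < c * E₀) → c < i * n → E₁ ≤ E₀
ratio⇒decreasing zero        E₀ i n c ratio c<in = z≤n
ratio⇒decreasing E₁@(suc _) E₀ i n c ratio c<in = <⇒≤ (*-cancelʳ-< (suc i * n) E₁ E₀ (begin-strict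
  E₁ * (suc i * n) <⟨ ratio (s≤s z≤n) ⟩
  c * E₀           ≤⟨ *-monoˡ-≤ E₀ (<⇒≤ c<in) ⟩
  i * n * E₀       ≤⟨ *-monoˡ-≤ E₀ (*-monoˡ-≤ n (n≤1+n i)) ⟩
  suc i * n * E₀   ≡⟨ *-comm (suc i * n) E₀ ⟩
  E₀ * (suc i * n) ∎))
  where open ≤-Reasoning

small-parameters : ∀ u w d n → w ≤ u → 10 * u ≤ n → 40 * d ≤ n → 90 ≤ n → 4 * (u + (w + (d + 2))) < n
small-parameters u w d n w≤u 10u≤n 40d≤n 90≤n = *-cancelˡ-≤ 10 (begin
  10 * suc (4 * (u + (w + (d + 2))))  ≡⟨ e₁ u w d ⟩
  40 * u + 40 * w + 40 * d + 90       ≤⟨ +-monoˡ-≤ 90 (+-monoˡ-≤ (40 * d) (+-monoʳ-≤ (40 * u) (*-monoʳ-≤ 40 w≤u))) ⟩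
  40 * u + 40 * u + 40 * d + 90       ≡⟨ e₂ u d ⟩
  8 * (10 * u) + 40 * d + 90          ≤⟨ +-mono-≤ (+-mono-≤ (*-monoʳ-≤ 8 10u≤n) 40d≤n) 90≤n ⟩
  8 * n + n + n                       ≡⟨ e₃ n ⟩
  10 * n                              ∎)
  where
  open ≤-Reasoning
  e₁ : ∀ u w d → 10 * suc (4 * (u + (w + (d + 2)))) ≡ 40 * u + 40 * w + 40 * d + 90
  e₁ = solve-∀
  e₂ : ∀ u d → 40 * u + 40 * u + 40 * d + 90 ≡ 8 * (10 * u) + 40 * d + 90
  e₂ = solve-∀
  e₃ : ∀ n → 8 * n + n + n ≡ 10 * n
  e₃ = solve-∀

lemma3p11 : (d : ℕ → ℕ)
    → (∀ k → ∃[ N ] ∀ n → N ≤ n → k * d n ≤ n)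
    → ∃[ N ] ∀ n → N ≤ n → 2 ∣ (d n * n)
      → (U W : Subset n) → ∣ W ∣ ≤ ∣ U ∣ → 10 * ∣ U ∣ ≤ n
      → ((i : ℕ) → 0 < numE n (d n) U W (suc i)
           → numE n (d n) U W (suc i) * (suc i * n)
             < 2 * ∣ U ∣ * ∣ W ∣ * d n * numE n (d n) U W i)
        × ((i : ℕ) → 2 * ∣ U ∣ * ∣ W ∣ * d n < i * n
           → numE n (d n) U W (suc i) ≤ numE n (d n) U W i)
-- The parity of d n * n only decides whether 𝓔 is empty; the switching argument does not need it.
lemma3p11 d d-sublinear = N + 90 , λ n N+90≤n _ U W w≤u 10u≤n →
  let 4β<n  = small-parameters ∣ U ∣ ∣ W ∣ (d n) n w≤u 10u≤n
                (40d≤n n (m+n≤o⇒m≤o N N+90≤n)) (m+n≤o⇒n≤o N N+90≤n)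
      ratio = λ i 0<E → switching-ratio _ _ i n (d n) ∣ U ∣ ∣ W ∣ 0<E (switching-inequality n (d n) U W i 4β<n)
  in ratio , λ i → ratio⇒decreasing _ _ i n _ (ratio i)
  where
  N = proj₁ (d-sublinear 40)
  40d≤n = proj₂ (d-sublinear 40)
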